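{- Fix $t\ge1$ and a finite set of cores $\mathsf{Cores}$ and stages. For each $k\ge1$ there is a bound $b_k$, independent of the program, such that for every program $\mathcal{P}$, every $t$-reordering bounded trace $\sigma$ of $\mathcal{P}$, and every $0\le j\le|\sigma|$, we have $|\mathsf{AC}_k(j)|\le b_k$.
   Context: A program $\mathcal{P}$ assigns to each core $c\in\mathsf{Cores}$ a finite instruction stream; an instruction $i$ has a core and a label (its index in the stream); $\mathsf{Instrs}(\mathcal{P})$ is the set of instructions; $i'\le_r i$ means same core and label of $i'$ at most that of $i$. Events are $i.\mathsf{st}$ for stages $\mathsf{st}$. A trace $\sigma=e_1\cdots e_{|\sigma|}$ of $\mathcal{P}$ lists each event of $\mathcal{P}$ exactly once; $e\to_{hb}e'$ means $e$ occurs before $e'$. For same-core $i_1,i_2$: $\mathsf{diff}_r(i_1,i_2)=\mathsf{label}(i_2)-\mathsf{label}(i_1)$. $\mathsf{start}(i)$/$\mathsf{end}(i)$: smallest/largest index of an event of $i$ in $\sigma$; $\mathsf{pfxend}(i)=\max\{\mathsf{end}(i'):i'\le_r i\}$. $\mathsf{coup}(i_1,i_2)$: the intervals $[\mathsf{start}(i_1),\mathsf{pfxend}(i_1)]$, $[\mathsf{start}(i_2),\mathsf{pfxend}(i_2)]$ overlap. $\sigma$ is $t$-reordering bounded if for all same-core $i_1,i_2$: (1) if $i_2.\mathsf{st}_2\to_{hb}i_1.\mathsf{st}_1$ then $\mathsf{diff}_r(i_1,i_2)<t$; (2) if $\mathsf{coup}(i_1,i)$ and $\mathsf{coup}(i,i_2)$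 for some $i$ then $|\mathsf{diff}_r(i_1,i_2)|<t$. For $0\le j\le|\sigma|$: $\mathsf{CM}(j)$/$\mathsf{NF}(j)$ = instructions all/none of whose events are among $e_1,\ldots,e_j$; $\mathsf{pCM}(j)=\{i:\forall i'\le_r i,\ i'\in\mathsf{CM}(j)\}$; $\mathsf{pNF}(j)=\{i:\forall i'\ge_r i,\ i'\in\mathsf{NF}(j)\}$; $\mathsf{IP}(j)=\mathsf{Instrs}(\mathcal{P})\setminus(\mathsf{pCM}(j)\cup\mathsf{pNF}(j))$. Instructions $i,i'$ are $k$-coupled if there are $i_1,\ldots,i_{k-1}$ with $\mathsf{coup}(i,i_1),\mathsf{coup}(i_1,i_2),\ldots,\mathsf{coup}(i_{k-1},i')$. $\mathsf{AC}_k(j)$ is the set of instructions in $\mathsf{pCM}(j)\cup\mathsf{IP}(j)$ that are $k$-coupled with some instruction of $\mathsf{IP}(j)$. -}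

module Defs where

open import Data.Nat using (ℕ; zero; suc; _≤_; _<_; _⊔_; _⊓_)
open import Data.Fin using (Fin; toℕ) renaming (zero to fzero; suc to fsuc)
open import Data.Integer as ℤ using (ℤ; +_; ∣_∣)
open import Data.Product using (Σ; _×_; _,_; proj₁; proj₂)
open import Data.Sum using (_⊎_)
open import Relation.Binary.PropositionalEquality using (_≡_)
open import Relation.Nullary using (¬_)
open import Function using (_∘_)

pfxMax : ∀ {n} → Fin n → (Fin n → ℕ) → ℕ
pfxMax {suc n} fzero     f = f fzero
pfxMax {suc n} (fsuc l)  f = f fzero ⊔ pfxMax l (f ∘ fsuc)

bigMax : ∀ {n} → (Fin (suc n) → ℕ) → ℕ
bigMax {zero}  f = f fzero
bigMax {suc n} f = f fzero ⊔ bigMax (f ∘ fsuc)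

bigMin : ∀ {n} → (Fin (suc n) → ℕ) → ℕ
bigMin {zero}  f = f fzero
bigMin {suc n} f = f fzero ⊓ bigMin (f ∘ fsuc)

-- Programs, instructions, events
-- Cores = Fin nC.  A program gives each core the length of its stream.

Program : ℕ → Set
Program nC = Fin nC → ℕ

Instr : ∀ {nC} → Program nC → Set
Instr {nC} P = Σ (Fin nC) (λ c → Fin (P c))

core : ∀ {nC} {P : Program nC} → Instr P → Fin nC
core = proj₁

label : ∀ {nC} {P : Program nC} → Instr P → ℕ
label i = toℕ (proj₂ i)

_≤r_ : ∀ {nC} {P : Program nC} → Instr P → Instr P → Set
i' ≤r i = (core i' ≡ core i) × (label i' ≤ label i)

-- Stages = Fin (suc s) (a nonempty finite set of stages)
Event : ∀ {nC} → Program nC → ℕ → Set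
Event P s = Instr P × Fin (suc s)

-- A trace: a sequence e_1 … e_N listing every event exactly once,
-- i.e. a bijection between positions and events.
-- Position p : Fin N (0-based) holds the event e_{p+1}.
record Trace {nC} (P : Program nC) (s : ℕ) : Set where
  field
    N      : ℕ
    ev     : Fin N → Event P s
    pos    : Event P s → Fin N
    ev-pos : ∀ e → ev (pos e) ≡ e
    pos-ev : ∀ p → pos (ev p) ≡ p
open Trace public

module _ {nC s} {P : Program nC} (σ : Trace P s) where

  idx : Event P s → ℕ
  idx e = suc (toℕ (pos σ e))

  _→hb_ : Event P s → Event P s → Set
  e →hb e' = idx e < idx e'

  start : Instr P → ℕ
  start i = bigMin (λ st → idx (i , st))

  end : Instr P → ℕ
  end i = bigMax (λ st → idx (i , st))

  pfxend : Instr P → ℕ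
  pfxend (c , l) = pfxMax l (λ l' → end (c , l'))

  coup : Instr P → Instr P → Set
  coup i₁ i₂ = (start i₁ ≤ pfxend i₂) × (start i₂ ≤ pfxend i₁)

  Coupled : ℕ → Instr P → Instr P → Set
  Coupled zero    i i' = i ≡ i'
  Coupled (suc k) i i' = Σ (Instr P) (λ i₁ → coup i i₁ × Coupled k i₁ i')

  CM : ℕ → Instr P → Set
  CM j i = ∀ st → idx (i , st) ≤ j

  NF : ℕ → Instr P → Set
  NF j i = ∀ st → j < idx (i , st)

  pCM : ℕ → Instr P → Set
  pCM j i = ∀ i' → i' ≤r i → CM j i'

  pNF : ℕ → Instr P → Set
  pNF j i = ∀ i' → i ≤r i' → NF j i'

  IP : ℕ → Instr P → Set
  IP j i = ¬ pCM j i × ¬ pNF j i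

  AC : ℕ → ℕ → Instr P → Set
  AC k j i = (pCM j i ⊎ IP j i) × Σ (Instr P) (λ i' → IP j i' × Coupled k i i')

diffr : ∀ {nC} {P : Program nC} → Instr P → Instr P → ℤ
diffr i₁ i₂ = + label i₂ ℤ.- + label i₁

ReorderingBounded : ∀ {nC s} {P : Program nC} → ℕ → Trace P s → Set
ReorderingBounded {nC} {s} {P} t σ =
  (∀ (c : Fin nC) (l₁ l₂ : Fin (P c)) (st₁ st₂ : Fin (suc s)) →
     _→hb_ σ ((c , l₂) , st₂) ((c , l₁) , st₁) →
     diffr {P = P} (c , l₁) (c , l₂) ℤ.< + t)
  × (∀ (c : Fin nC) (l₁ l₂ : Fin (P c)) (i : Instr P) →
     coup σ (c , l₁) i → coup σ i (c , l₂) →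
     ∣ diffr {P = P} (c , l₁) (c , l₂) ∣ < t)

-- Two instructions of one core that are both in progress at step j, or both coupled to a
-- common instruction, have labels less than t apart by t-reordering boundedness, so each
-- such family has at most 2t members per core, hence at most W = |Cores|·2t in total.
-- IP(j) is such a family, and the instructions coupled in k+1 steps to IP(j) are covered
-- by the neighbourhoods of those coupled in k steps, which gives |AC_k(j)| ≤ W^(k+1).
module Submission where

open import Defs
open import Data.Nat using (ℕ; zero; suc; _+_; _*_; _^_; _∸_; _≤_; _<_; z≤n; s≤s; s≤s⁻¹)
open import Data.Nat.Properties
open import Data.Fin as Fin using (Fin; toℕ)
open import Data.Fin.Properties using (toℕ-injective; toℕ<n; any?)
open import Data.Integer as ℤ using (+_; +≤+; +<+; ∣_∣)
open import Data.Integer.Properties using (m-n≡m⊖n; ⊖-≥; ∣-∣-≤; drop‿+<+)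
open import Data.List using (List; []; _∷_; length; map; filter)
open import Data.List.Properties using (length-map)
open import Data.List.Relation.Unary.All as All using (All; []; _∷_)
open import Data.List.Relation.Unary.All.Properties using (all-filter) renaming (filter⁺ to All-filter⁺; map⁺ to All-map⁺)
open import Data.List.Relation.Unary.AllPairs using ([]; _∷_)
open import Data.List.Relation.Unary.Unique.Propositional using (Unique)
open import Data.List.Relation.Unary.Unique.Propositional.Properties as Unique using ()
open import Data.Product using (Σ; ∃-syntax; _×_; _,_; proj₁; proj₂; swap)
open import Data.Product.Properties using (≡-dec)
open import Data.Unit using (tt)
open import Data.Empty using (⊥-elim)
open import Relation.Nullary using (¬_; yes; no; _×-dec_)
open import Relation.Unary using (U; _∩_; ∁; _⊆_; Decidable)
open import Relation.Unary.Properties using (∁?)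
open import Relation.Binary.Definitions using (DecidableEquality)
open import Relation.Binary.PropositionalEquality using (_≡_; _≢_; refl; sym; trans; cong; subst)
open import Function using (_∘_)

AtMost : {A : Set} → (A → Set) → ℕ → Set
AtMost {A} P n = (xs : List A) → Unique xs → All P xs → length xs ≤ n

length-filter-∁ : ∀ {A : Set} {P : A → Set} (P? : Decidable P) xs →
  length (filter P? xs) + length (filter (∁? P?) xs) ≡ length xs
length-filter-∁ P? [] = refl
length-filter-∁ P? (x ∷ xs) with ih ← length-filter-∁ P? xs | P? x
... | yes _ = cong suc ih
... | no  _ = trans (+-suc _ _) (cong suc ih)

module _ {A : Set} {P : A → Set} where

  AtMost-mono : ∀ {Q : A → Set} {n} → Q ⊆ P → AtMost P n → AtMost Q n
  AtMost-mono Q⊆P P≤n xs u qs = P≤n xs u (All.map Q⊆P qs)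

  AtMost-zero : ∀ {x} → AtMost P 0 → ¬ P x
  AtMost-zero P≤0 px with () ← P≤0 (_ ∷ []) ([] ∷ []) (px ∷ [])

  AtMost-delete : ∀ {x n} → P x → AtMost P (suc n) → AtMost (P ∩ (_≢ x)) n
  AtMost-delete px P≤1+n ys u ps = s≤s⁻¹ (P≤1+n (_ ∷ ys)
    (All.map (λ (_ , y≢x) → y≢x ∘ sym) ps ∷ u) (px ∷ All.map proj₁ ps))

  AtMost-split : ∀ {Q : A → Set} {a b} → Decidable Q →
    AtMost (P ∩ Q) a → AtMost (P ∩ ∁ Q) b → AtMost P (a + b)
  AtMost-split Q? PQ≤a P¬Q≤b xs u ps = subst (_≤ _) (length-filter-∁ Q? xs) (+-mono-≤
    (PQ≤a _ (Unique.filter⁺ Q? u) (All.zip (All-filter⁺ Q? ps , all-filter Q? xs)))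
    (P¬Q≤b _ (Unique.filter⁺ (∁? Q?) u) (All.zip (All-filter⁺ (∁? Q?) ps , all-filter (∁? Q?) xs))))

  AtMost-map : ∀ {B : Set} {Q : B → Set} {n} (f : A → B) → (∀ {x} → P x → Q (f x)) →
    (∀ {x y} → P x → P y → f x ≡ f y → x ≡ y) → AtMost Q n → AtMost P n
  AtMost-map f pres inj Q≤n xs u ps =
    subst (_≤ _) (length-map f xs) (Q≤n (map f xs) (unique-map u ps) (All-map⁺ (All.map pres ps)))
    where
      unique-map : ∀ {xs} → Unique xs → All P xs → Unique (map f xs)
      unique-map [] [] = []
      unique-map (x∉xs ∷ u) (px ∷ ps) =
        All-map⁺ (All.zipWith (λ (x≢y , py) fx≡fy → x≢y (inj px py fx≡fy)) (x∉xs , ps)) ∷ unique-map u ps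

AtMost-≡ : ∀ {A : Set} (a : A) → AtMost (_≡ a) 1
AtMost-≡ a []           _                 _               = z≤n
AtMost-≡ a (_ ∷ [])     _                 _               = s≤s z≤n
AtMost-≡ a (_ ∷ _ ∷ _)  ((x≢y ∷ _) ∷ _)  (refl ∷ refl ∷ _) = ⊥-elim (x≢y refl)

AtMost-< : ∀ n → AtMost (_< n) n
AtMost-< zero    []      _ _         = z≤n
AtMost-< zero    (_ ∷ _) _ (() ∷ _)
AtMost-< (suc n) = AtMost-split (_≟ n)
  (AtMost-mono proj₂ (AtMost-≡ n))
  (AtMost-mono (λ (v<1+n , v≢n) → ≤∧≢⇒< (s≤s⁻¹ v<1+n) v≢n) (AtMost-< n))

AtMost-Fin : ∀ n → AtMost {Fin n} U n
AtMost-Fin n = AtMost-map toℕ (λ {i} _ → toℕ<n i) (λ _ _ → toℕ-injective) (AtMost-< n)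

AtMost-interval : ∀ lo w → AtMost (λ v → lo ≤ v × v < lo + w) w
AtMost-interval lo w = AtMost-map (_∸ lo)
  (λ {v} (lo≤v , v<lo+w) → subst (v ∸ lo <_) (m+n∸m≡n lo w) (∸-monoˡ-< v<lo+w lo≤v))
  (λ (lo≤v , _) (lo≤v′ , _) → ∸-cancelʳ-≡ lo≤v lo≤v′)
  (AtMost-< w)

-- Anchored at any member x₀, the values f x + t all lie in [f x₀ + 1, f x₀ + 1 + 2t).
AtMost-close : ∀ {A : Set} {P : A → Set} (t : ℕ) (f : A → ℕ) →
  (∀ {x y} → P x → P y → f x ≡ f y → x ≡ y) →
  (∀ {x y} → P x → P y → f x < f y + t) → AtMost P (t + t)
AtMost-close t f inj close []           _ _            = z≤n
AtMost-close t f inj close xs@(x₀ ∷ _)  u ps@(p₀ ∷ _) =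
  AtMost-map (λ x → f x + t) (λ p → close p₀ p , shifted (close p p₀))
    (λ p q e → inj p q (+-cancelʳ-≡ _ _ _ e)) (AtMost-interval (suc (f x₀)) (t + t)) xs u ps
  where
    shifted : ∀ {v} → v < f x₀ + t → v + t < suc (f x₀) + (t + t)
    shifted {v} v<a+t = begin-strict
      v + t              <⟨ +-monoˡ-< t v<a+t ⟩
      f x₀ + t + t       ≡⟨ +-assoc (f x₀) t t ⟩
      f x₀ + (t + t)     <⟨ n<1+n _ ⟩
      suc (f x₀) + (t + t) ∎
      where open ≤-Reasoning

module _ {A C : Set} where

  Graph : (C → Set) → (C → A → Set) → A × C → Set
  Graph S R (x , c) = S c × R c x

  AtMost-Graph : ∀ {m n} {S : C → Set} {R : C → A → Set} → DecidableEquality C →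
    AtMost S m → (∀ {c} → S c → AtMost (R c) n) → AtMost (Graph S R) (m * n)
  AtMost-Graph _ S≤m R≤n [] _ _ = z≤n
  AtMost-Graph {zero} _ S≤m R≤n (_ ∷ _) _ ((s , _) ∷ _) = ⊥-elim (AtMost-zero S≤m s)
  AtMost-Graph {suc m} {S = S} {R} _≟_ S≤m R≤n zs@((_ , c) ∷ _) u ps@((s , _) ∷ _) =
    AtMost-split (λ z → proj₂ z ≟ c) fibre rest zs u ps
    where
      fibre : AtMost (Graph S R ∩ (λ z → proj₂ z ≡ c)) _
      fibre = AtMost-map proj₁ (λ { ((_ , r) , refl) → r })
        (λ { (_ , refl) (_ , refl) refl → refl }) (R≤n s)
      rest : AtMost (Graph S R ∩ ∁ (λ z → proj₂ z ≡ c)) (m * _)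
      rest = AtMost-mono (λ ((s′ , r) , c′≢c) → (s′ , c′≢c) , r)
        (AtMost-Graph _≟_ (AtMost-delete s S≤m) (R≤n ∘ proj₁))

  witnesses : ∀ {Q : A × C → Set} {xs} → All (λ x → ∃[ c ] Q (x , c)) xs →
    ∃[ zs ] map proj₁ zs ≡ xs × All Q zs
  witnesses [] = [] , refl , []
  witnesses {xs = x ∷ _} ((c , q) ∷ qs) with zs , refl , qzs ← witnesses qs =
    (x , c) ∷ zs , refl , q ∷ qzs

  AtMost-∃ : ∀ {Q : A × C → Set} {n} → AtMost Q n → AtMost (λ x → ∃[ c ] Q (x , c)) n
  AtMost-∃ Q≤n xs u qs with zs , refl , qzs ← witnesses qs =
    subst (_≤ _) (sym (length-map proj₁ zs)) (Q≤n zs (Unique.map⁻ u) qzs)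

  AtMost-⋃ : ∀ {m n} {S : C → Set} {R : C → A → Set} → DecidableEquality C →
    AtMost S m → (∀ {c} → S c → AtMost (R c) n) → AtMost (λ x → ∃[ c ] S c × R c x) (m * n)
  AtMost-⋃ _≟_ S≤m R≤n = AtMost-∃ (AtMost-Graph _≟_ S≤m R≤n)

AtMost-sameCoreClose : ∀ {nC} {P : Program nC} {B : Instr P → Set} (t : ℕ) →
  (∀ {x y} → B x → B y → core x ≡ core y → label x < label y + t) → AtMost B (nC * (t + t))
AtMost-sameCoreClose {nC} {P} {B} t close =
  AtMost-mono (λ {x} b → core x , tt , refl , b)
    (AtMost-⋃ Fin._≟_ (AtMost-Fin nC) (λ _ → AtMost-close t label sameLabel onCore))
  where
    sameLabel : ∀ {c x y} → core x ≡ c × B x → core y ≡ c × B y → label x ≡ label y → x ≡ y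
    sameLabel {x = _ , _} {y = _ , _} (refl , _) (refl , _) e = cong (_ ,_) (toℕ-injective e)
    onCore : ∀ {c x y} → core x ≡ c × B x → core y ≡ c × B y → label x < label y + t
    onCore (refl , bx) (e , by) = close bx by (sym e)

+m-+n≡+[m∸n] : ∀ {m n} → n ≤ m → + m ℤ.- + n ≡ + (m ∸ n)
+m-+n≡+[m∸n] {m} {n} n≤m = trans (m-n≡m⊖n m n) (⊖-≥ n≤m)

diff<⇒<+ : ∀ {a b t} → + a ℤ.- + b ℤ.< + t → a < b + t
diff<⇒<+ {a} {b} {t} a-b<t with b ≤? a
... | yes b≤a = subst (_< b + t) (m+[n∸m]≡n b≤a)
      (+-monoʳ-< b (drop‿+<+ (subst (ℤ._< + t) (+m-+n≡+[m∸n] b≤a) a-b<t)))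
... | no  b≰a = m≤n⇒m≤n+o t (≰⇒> b≰a)

∣diff∣<⇒<+ : ∀ {a b t} → ∣ + b ℤ.- + a ∣ < t → a < b + t
∣diff∣<⇒<+ {a} {b} {t} ∣b-a∣<t with b ≤? a
... | yes b≤a = diff<⇒<+ (subst (ℤ._< + t) (∣-∣-≤ (+≤+ b≤a)) (+<+ ∣b-a∣<t))
... | no  b≰a = m≤n⇒m≤n+o t (≰⇒> b≰a)

module _ {t nC s} {P : Program nC} {σ : Trace P s} (rb : ReorderingBounded t σ) (j : ℕ) where

  ¬pCM⇒unfinished : ∀ {c l} → ¬ pCM σ j (c , l) →
    ∃[ l′ ] toℕ l′ ≤ toℕ l × ∃[ st ] j < idx σ ((c , l′) , st)
  ¬pCM⇒unfinished {c} {l} ¬cm with any? (λ l′ → (toℕ l′ ≤? toℕ l) ×-dec any? (λ st → j <? idx σ ((c , l′) , st)))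
  ... | yes w  = w
  ... | no  ¬w = ⊥-elim (¬cm λ { (_ , l′) (refl , l′≤l) st → ≮⇒≥ λ j< → ¬w (l′ , l′≤l , st , j<) })

  ¬pNF⇒started : ∀ {c l} → ¬ pNF σ j (c , l) →
    ∃[ l′ ] toℕ l ≤ toℕ l′ × ∃[ st ] idx σ ((c , l′) , st) ≤ j
  ¬pNF⇒started {c} {l} ¬nf with any? (λ l′ → (toℕ l ≤? toℕ l′) ×-dec any? (λ st → idx σ ((c , l′) , st) ≤? j))
  ... | yes w  = w
  ... | no  ¬w = ⊥-elim (¬nf λ { (_ , l′) (refl , l≤l′) st → ≰⇒> λ ≤j → ¬w (l′ , l≤l′ , st , ≤j) })

  -- Some instruction after x has an event by step j and some instruction before y has one
  -- after step j, so the first reordering condition bounds their label distance.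
  IP-close : ∀ {x y} → IP σ j x → IP σ j y → core x ≡ core y → label x < label y + t
  IP-close {c , lx} {_ , ly} (_ , ¬nf) (¬cm , _) refl
    with l₂ , lx≤l₂ , st₂ , started ← ¬pNF⇒started ¬nf
       | l₁ , l₁≤ly , st₁ , unfinished ← ¬pCM⇒unfinished ¬cm = begin-strict
    toℕ lx       ≤⟨ lx≤l₂ ⟩
    toℕ l₂       <⟨ diff<⇒<+ (proj₁ rb c l₁ l₂ st₁ st₂ (≤-<-trans started unfinished)) ⟩
    toℕ l₁ + t   ≤⟨ +-monoˡ-≤ t l₁≤ly ⟩
    toℕ ly + t   ∎
    where open ≤-Reasoning

  coup-close : ∀ {i x y} → coup σ x i → coup σ y i → core x ≡ core y → label x < label y + t
  coup-close {i} {c , _} {_ , _} xi yi refl = ∣diff∣<⇒<+ (proj₂ rb c _ _ i xi (swap yi))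

  CoupledToIP : ℕ → Instr P → Set
  CoupledToIP k x = ∃[ y ] IP σ j y × Coupled σ k x y

  AtMost-CoupledToIP : ∀ k → AtMost (CoupledToIP k) ((nC * (t + t)) ^ suc k)
  AtMost-CoupledToIP zero = subst (AtMost _) (sym (*-identityʳ _))
    (AtMost-mono (λ { (_ , ip , refl) → ip }) (AtMost-sameCoreClose t IP-close))
  AtMost-CoupledToIP (suc k) = subst (AtMost _) (*-comm _ (nC * (t + t)))
    (AtMost-mono (λ { (y , ip , i , xi , ik) → i , (y , ip , ik) , xi })
      (AtMost-⋃ (≡-dec Fin._≟_ Fin._≟_) (AtMost-CoupledToIP k)
        (λ {i} _ → AtMost-sameCoreClose t (coup-close {i}))))

lemma5 : (t : ℕ) → 1 ≤ t → (nC s : ℕ) → (k : ℕ) → 1 ≤ k →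
    Σ ℕ (λ b → ∀ (P : Program nC) (σ : Trace P s) → ReorderingBounded t σ →
      ∀ (j : ℕ) → j ≤ N σ →
      ∀ (xs : List (Instr P)) → Unique xs → All (AC σ k j) xs → length xs ≤ b)
lemma5 t _ nC s k _ = (nC * (t + t)) ^ suc k ,
  λ P σ rb j _ xs u acs → AtMost-CoupledToIP rb j k xs u (All.map proj₂ acs)
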